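{- Let $\psi$ be a reduced function with $\delta(\psi)<\sqrt3$. Then either the family $(t_k)$ associated with $\psi$ is finite, or $\psi(t_k)=t_{k-1}-1$ for all sufficiently large $k$.
   Context: $\mathcal{A}$ is an alphabet disjoint from $\mathbb{N}^*=\{1,2,\dots\}$. A function here is a map $\psi:\mathbb{N}^*\to\mathbb{N}^*\sqcup\mathcal{A}$ with, for each $n\ge1$, either $\psi(n)\in\mathcal{A}$ or $1\le\psi(n)\le n-1$. The family $(t_k)_{k\ge0}$ is the (finite or infinite) increasing enumeration of all $n\ge1$ with $1\le\psi(n)\le n-2$ or $\psi(n)\in\mathcal{A}$. $\psi$ is reduced if for every $k\ge1$ such that $t_k$ exists: $\psi(t_k)\ne\psi(t_{k-1})$, and either $\psi(t_k)\in\mathcal{A}$ or $\psi(t_k)<t_{k-1}$. For reduced $\psi$, let $n_1=0$ and $n_{i+1}=2n_i-n_{\psi(i)}$ if $\psi(i)\in\mathbb{N}^*$, $n_{i+1}=2n_i+1$ if $\psi(i)\in\mathcal{A}$; $\delta(\psi)=\limsup_{i\to\infty} n_{i+1}/n_i$. -}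

module Defs where

open import Data.Nat using (ℕ; zero; suc; _≤_; _<_; _∸_; _*_)
open import Data.Integer as ℤ using (ℤ; +_; 0ℤ; 1ℤ)
open import Data.List using (List; []; _∷_; _++_; [_])
open import Data.Sum using (_⊎_; inj₁; inj₂)
open import Data.Product using (_×_; ∃; ∃-syntax; Σ-syntax)
open import Relation.Nullary using (¬_)
open import Relation.Binary.PropositionalEquality using (_≡_; _≢_)

-- A "function" ψ : ℕ* → ℕ* ⊔ 𝒜 is modelled as ψ : ℕ → 𝒜 ⊎ ℕ, where
-- inj₁ a means ψ(n) = a ∈ 𝒜 and inj₂ m means ψ(n) = m ∈ ℕ*.
-- The value at 0 is irrelevant (0 is not in the domain ℕ*).

module _ {𝒜 : Set} (ψ : ℕ → 𝒜 ⊎ ℕ) where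

  IsFunction : Set
  IsFunction = ∀ n → 1 ≤ n → (∃[ a ] ψ n ≡ inj₁ a) ⊎ (∃[ m ] (ψ n ≡ inj₂ m × 1 ≤ m × m ≤ n ∸ 1))

  InT : ℕ → Set
  InT n = 1 ≤ n × ((∃[ a ] ψ n ≡ inj₁ a) ⊎ (∃[ m ] (ψ n ≡ inj₂ m × 1 ≤ m × m ≤ n ∸ 2)))

  -- a and b are consecutive terms t_{k-1} = a, t_k = b of the increasing
  -- enumeration (t_k) of InT
  Consecutive : ℕ → ℕ → Set
  Consecutive a b = InT a × InT b × a < b × (∀ c → a < c → c < b → ¬ InT c)

  Reduced : Set
  Reduced = ∀ a b → Consecutive a b →
    ψ b ≢ ψ a × ((∃[ x ] ψ b ≡ inj₁ x) ⊎ (∃[ m ] (ψ b ≡ inj₂ m × m < a)))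

  TFinite : Set
  TFinite = ∃[ B ] (∀ n → InT n → n ≤ B)

  -- safe list indexing with default 0 (only used at valid indices
  -- when ψ is a function)
  nth : List ℤ → ℕ → ℤ
  nth []       _       = 0ℤ
  nth (x ∷ xs) zero    = x
  nth (x ∷ xs) (suc k) = nth xs k

  step : 𝒜 ⊎ ℕ → ℤ → List ℤ → ℤ
  step (inj₁ _) x _   = (+ 2) ℤ.* x ℤ.+ 1ℤ
  step (inj₂ m) x tab = (+ 2) ℤ.* x ℤ.- nth tab (m ∸ 1)

  -- table k = [ n_1 , … , n_k ]
  table : ℕ → List ℤ
  table zero                = []
  table (suc zero)          = 0ℤ ∷ []
  table (suc (suc k))       =
    table (suc k) ++ [ step (ψ (suc k)) (nth (table (suc k)) k) (table (suc k)) ]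

  -- nSeq i = n_i  (for i ≥ 1): n_1 = 0, n_{i+1} = 2 n_i - n_{ψ(i)} or 2 n_i + 1
  nSeq : ℕ → ℤ
  nSeq i = nth (table i) (i ∸ 1)

  -- δ(ψ) = limsup n_{i+1}/n_i < √3, unfolded as: there is a rational
  -- p/q with (p/q)² < 3 such that n_{i+1}/n_i ≤ p/q for all large i
  -- (n_i > 0 for i ≥ 2, so the division is cleared by multiplying).
  DeltaLtSqrt3 : Set
  DeltaLtSqrt3 = ∃[ p ] ∃[ q ] (1 ≤ q × p * p < 3 * (q * q) ×
    ∃[ N ] (∀ i → N ≤ i → (+ q) ℤ.* nSeq (suc i) ℤ.≤ (+ p) ℤ.* nSeq i))

{-# OPTIONS --safe #-}
module Submission where

-- Write Δ i = n (i + 1) − n i; it equals n i − n ψ(i), or n i + 1 when ψ(i) is a letter.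
-- Off the family (t_k) one has ψ(i) = i − 1, so n is affine between consecutive terms,
-- and reducedness gives n (t − 1) ≤ Δ t for every term t, by induction along the family.
-- Let r = p/q, with r² < 3, bound n (i + 1) / n i for i ≥ N. Beyond a threshold K no
-- letter occurs (its ratio exceeds 2) and every back-reference ψ(t_k) exceeds N (else
-- the ratio is at least 2). Let a′ < a < b be consecutive terms past K with ψ(b) ≤ a − 2;
-- by reducedness ψ(a) < a′. With x = n a′ and D = Δ a′, the ratio bounds at a′, a and b
-- force r² ≥ 3 when ψ(b) < a′ or ψ(b) = a′ = a − 2, and r ≥ 7/4 when a ≥ a′ + 3.

open import Defs
open import Data.Nat as ℕ using (ℕ; zero; suc; z≤n; s≤s; _∸_)
import Data.Nat.Properties as ℕ
open import Data.Nat.Induction using (<-wellFounded)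
open import Data.Integer as ℤ using (ℤ; +_; +[1+_]; +≤+; +<+; 0ℤ; 1ℤ; _+_; _-_; _*_; -_; ∣_∣)
import Data.Integer.Properties as ℤ
open import Data.Integer.Tactic.RingSolver using (solve; solve-∀)
open import Data.List using (List; []; _∷_; _++_; [_]; length)
open import Data.List.Properties using (length-++)
open import Data.Sum using (_⊎_; inj₁; inj₂; [_,_]′)
open import Data.Sum.Properties using (inj₂-injective)
open import Data.Product using (_×_; _,_; ∃-syntax; proj₁; proj₂)
open import Data.Empty using (⊥-elim)
open import Induction.WellFounded using (Acc; acc)
open import Relation.Nullary using (¬_; Dec; yes; no; contradiction)
open import Relation.Nullary.Decidable using (map′; _×-dec_; toSum)
open import Relation.Unary using (Decidable)
open import Relation.Binary.PropositionalEquality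
  using (_≡_; _≢_; refl; sym; trans; cong; cong₂; subst; subst₂; module ≡-Reasoning)

module Certificates where

  open import Data.Integer using (_≤_; _<_; _≰_)

  -- An inequality is refuted by a nonnegative combination s of slacks of the hypotheses and a
  -- positive t with s + t = 0, an identity checked by the ring solver.

  private variable
    i j : ℤ

  infixl 6 _⊕_
  infixl 7 _⊛_ _⊛⁺_ _·_ _·⁺_

  _⊕_ : 0ℤ ≤ i → 0ℤ ≤ j → 0ℤ ≤ i + j
  _⊕_ = ℤ.+-mono-≤

  _⊛_ : 0ℤ ≤ i → 0ℤ ≤ j → 0ℤ ≤ i * j
  _⊛_ {+ m} {+ n} _ _ = subst (0ℤ ≤_) (ℤ.pos-* m n) (+≤+ z≤n)

  _⊛⁺_ : 0ℤ < i → 0ℤ < j → 0ℤ < i * j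
  _⊛⁺_ {+[1+ m ]} {+[1+ n ]} _ _ = +<+ ℕ.z<s
  _⊛⁺_ {+ 0} (+<+ ())
  _⊛⁺_ {+[1+ m ]} {+ 0} _ (+<+ ())

  _·_ : ∀ c → 0ℤ ≤ i → 0ℤ ≤ + c * i
  c · 0≤i = +≤+ (z≤n {c}) ⊛ 0≤i

  _·⁺_ : ∀ c .{{_ : ℕ.NonZero c}} → 0ℤ < i → 0ℤ < + c * i
  _·⁺_ {+[1+ m ]} (suc c) _ = +<+ ℕ.z<s
  _·⁺_ {+ 0} (suc c) (+<+ ())

  slack : i ≤ j → 0ℤ ≤ j - i
  slack = ℤ.i≤j⇒0≤j-i

  slack⁺ : i < j → 0ℤ < j - i
  slack⁺ {i} {j} i<j = subst (_< j - i) (ℤ.+-inverseʳ i) (ℤ.+-monoˡ-< (- i) i<j)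

  slack-suc : i < j → 0ℤ ≤ j - (i + 1ℤ)
  slack-suc {i} {j} i<j = subst (λ k → 0ℤ ≤ j - k) (ℤ.+-comm 1ℤ i) (slack (ℤ.i<j⇒suc[i]≤j i<j))

  0≤∧0<⇒+≢0 : 0ℤ ≤ i → 0ℤ < j → i + j ≢ 0ℤ
  0≤∧0<⇒+≢0 0≤i 0<j i+j≡0 = ℤ.<-irrefl refl (subst (0ℤ <_) i+j≡0 (ℤ.+-mono-≤-< 0≤i 0<j))

  ≤-from-slack : ∀ {s} → 0ℤ ≤ s → s ≡ j - i → i ≤ j
  ≤-from-slack 0≤s s≡j-i = ℤ.0≤i-j⇒j≤i (subst (0ℤ ≤_) s≡j-i 0≤s)

  0≤i⇒i<2i+1 : ∀ {i} → 0ℤ ≤ i → i < + 2 * i + 1ℤ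
  0≤i⇒i<2i+1 {i} 0≤i = ℤ.≰⇒> λ (2i+1≤i : + 2 * i + 1ℤ ≤ i) →
    0≤∧0<⇒+≢0 (slack 2i+1≤i ⊕ 0≤i) (+<+ ℕ.z<s) (solve (i ∷ []))

  j<i⇒i<2i-j : ∀ {i j} → j < i → i < + 2 * i - j
  j<i⇒i<2i-j {i} {j} j<i = ℤ.≰⇒> λ (2i-j≤i : + 2 * i - j ≤ i) →
    0≤∧0<⇒+≢0 (slack 2i-j≤i) (slack⁺ j<i) (solve (i ∷ j ∷ []))

  i≤i+j-k : ∀ {i j k} → k ≤ j → i ≤ i + j - k
  i≤i+j-k {i} {j} {k} k≤j = ≤-from-slack (slack k≤j) (solve (i ∷ j ∷ k ∷ []))

  P²<3Q²⇒4P<7Q : ∀ {P Q} → 0ℤ ≤ P → 0ℤ ≤ Q → P * P < + 3 * (Q * Q) → + 4 * P < + 7 * Q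
  P²<3Q²⇒4P<7Q {P} {Q} 0≤P 0≤Q P²<3Q² = ℤ.≰⇒> λ (7Q≤4P : + 7 * Q ≤ + 4 * P) →
    0≤∧0<⇒+≢0 (slack 7Q≤4P ⊛ (4 · 0≤P ⊕ 7 · 0≤Q) ⊕ 0≤Q ⊛ 0≤Q) (16 ·⁺ slack⁺ P²<3Q²)
      (solve (P ∷ Q ∷ []))

  4P<7Q⇒P<2Q : ∀ {P Q} → 0ℤ ≤ Q → + 4 * P < + 7 * Q → P < + 2 * Q
  4P<7Q⇒P<2Q {P} {Q} 0≤Q 4P<7Q = ℤ.≰⇒> λ (2Q≤P : + 2 * Q ≤ P) →
    0≤∧0<⇒+≢0 (4 · slack 2Q≤P ⊕ 0≤Q) (slack⁺ 4P<7Q) (solve (P ∷ Q ∷ []))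

  -- Below, Q * b ≤ P * a reads b ≤ r · a with r = P / Q.

  letter⇒2Q<P : ∀ {P Q y} → 0ℤ < Q → 0ℤ ≤ y → Q * (+ 2 * y + 1ℤ) ≤ P * y → + 2 * Q < P
  letter⇒2Q<P {P} {Q} {y} 0<Q 0≤y step-y = ℤ.≰⇒> λ (P≤2Q : P ≤ + 2 * Q) →
    0≤∧0<⇒+≢0 (slack step-y ⊕ slack P≤2Q ⊛ 0≤y) 0<Q (solve (P ∷ Q ∷ y ∷ []))

  small-reference⇒2Q≤P : ∀ {P Q y u v} → 0ℤ ≤ Q → 0ℤ ≤ y → Q * u < y → v ≤ u →
    Q * (+ 2 * y - v) ≤ P * y → + 2 * Q ≤ P
  small-reference⇒2Q≤P {P} {Q} {y} {u} {v} 0≤Q 0≤y Qu<y v≤u step-y =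
    ℤ.≮⇒≥ λ (P<2Q : P < + 2 * Q) →
    0≤∧0<⇒+≢0 (slack step-y ⊕ 0≤Q ⊛ slack v≤u ⊕ slack-suc P<2Q ⊛ 0≤y) (slack⁺ Qu<y)
      (solve (P ∷ Q ∷ y ∷ u ∷ v ∷ []))

  reference-below-D⇒3Q²≤P² : ∀ {P Q x D y v z w} → 0ℤ ≤ Q → P ≤ + 2 * Q → 0ℤ ≤ D → 0ℤ < x →
    Q * (x + D) ≤ P * x → x + D ≤ y → v ≤ D → + 2 * y - v ≤ z → w ≤ D →
    Q * (+ 2 * z - w) ≤ P * z → + 3 * (Q * Q) ≤ P * P
  reference-below-D⇒3Q²≤P² {P} {Q} {x} {D} {y} {v} {z} {w}
    0≤Q P≤2Q 0≤D 0<x step-x x+D≤y v≤D 2y-v≤z w≤D step-z =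
    [ (λ (Q≤P : Q ≤ P) → ℤ.≮⇒≥ λ (P²<3Q² : P * P < + 3 * (Q * Q)) →
        0≤∧0<⇒+≢0 (slack Q≤P ⊛ slack step-x ⊕ 0≤Q ⊛ (slack step-z ⊕ 0≤Q ⊛ slack w≤D
                   ⊕ slack P≤2Q ⊛ (slack 2y-v≤z ⊕ 2 · slack x+D≤y ⊕ slack v≤D)))
          (0<x ⊛⁺ slack⁺ P²<3Q²)
          (solve (P ∷ Q ∷ x ∷ D ∷ y ∷ v ∷ z ∷ w ∷ [])))
    , (λ (Q≰P : Q ≰ P) → ⊥-elim (0≤∧0<⇒+≢0
        (slack step-x ⊕ 0≤Q ⊛ 0≤D) (slack⁺ (ℤ.≰⇒> Q≰P) ⊛⁺ 0<x)
        (solve (P ∷ Q ∷ x ∷ D ∷ []))))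
    ]′ (toSum (Q ℤ.≤? P))

  reference-to-x⇒3Q²≤P² : ∀ {P Q x D y v z} → 0ℤ ≤ Q → P ≤ + 2 * Q → 0ℤ ≤ D → 0ℤ < x →
    x + + 2 * D ≤ y → v ≤ D → Q * (+ 2 * y - v) ≤ P * y → + 2 * y - v ≤ z →
    Q * (+ 2 * z - x) ≤ P * z → + 3 * (Q * Q) ≤ P * P
  reference-to-x⇒3Q²≤P² {P} {Q} {x} {D} {y} {v} {z}
    0≤Q P≤2Q 0≤D 0<x x+2D≤y v≤D step-y 2y-v≤z step-z =
    let h₁ = slack step-y ⊕ 0≤Q ⊛ slack v≤D ⊕ slack P≤2Q ⊛ slack x+2D≤y
        h₂ = slack step-z ⊕ slack P≤2Q ⊛ (slack 2y-v≤z ⊕ 2 · slack x+2D≤y ⊕ slack v≤D)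
    in [ (λ (3Q≤2P : + 3 * Q ≤ + 2 * P) → ℤ.≮⇒≥ λ (P²<3Q² : P * P < + 3 * (Q * Q)) →
           0≤∧0<⇒+≢0 (3 · slack P≤2Q ⊛ h₁ ⊕ slack 3Q≤2P ⊛ h₂) (0<x ⊛⁺ slack⁺ P²<3Q²)
             (solve (P ∷ Q ∷ x ∷ D ∷ y ∷ v ∷ z ∷ [])))
       , (λ (3Q≰2P : + 3 * Q ≰ + 2 * P) → let 0<t = slack⁺ (ℤ.≰⇒> 3Q≰2P) in ⊥-elim (0≤∧0<⇒+≢0
           (2 · h₁ ⊕ 2 · ℤ.<⇒≤ 0<t ⊛ 0≤D ⊕ 0≤Q ⊛ ℤ.<⇒≤ 0<x) (0<t ⊛⁺ 0<x)
           (solve (P ∷ Q ∷ x ∷ D ∷ y ∷ v ∷ z ∷ []))))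
       ]′ (toSum (+ 3 * Q ℤ.≤? + 2 * P))

  -- 7/4 comes from 3r² − 7r + 3 < 0 on [5/3, 7/4); below 5/3 the step at y alone is impossible.
  three-steps⇒7Q≤4P : ∀ {P Q x D y v} → 0ℤ ≤ Q → 0ℤ ≤ D → 0ℤ < x → Q * (x + D) ≤ P * x →
    x + + 3 * D ≤ y → v ≤ D → Q * (+ 2 * y - v) ≤ P * y → + 7 * Q ≤ + 4 * P
  three-steps⇒7Q≤4P {P} {Q} {x} {D} {y} {v} 0≤Q 0≤D 0<x step-x x+3D≤y v≤D step-y =
    ℤ.≮⇒≥ λ (4P<7Q : + 4 * P < + 7 * Q) →
    let 0<t = slack⁺ 4P<7Q
        0≤t = ℤ.<⇒≤ 0<t
        h₁ = 4 · slack step-y ⊕ 4 · (0≤Q ⊛ slack v≤D) ⊕ (0≤Q ⊕ 0≤t) ⊛ slack x+3D≤y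
    in [ (λ (5Q≤3P : + 5 * Q ≤ + 3 * P) → let 0≤s = slack 5Q≤3P in
           0≤∧0<⇒+≢0 (0≤Q ⊛ h₁ ⊕ 4 · (0≤s ⊛ slack step-x)
                       ⊕ ℤ.<⇒≤ 0<x ⊛ (9 · (0≤s ⊛ 0≤t) ⊕ (4 · 0≤s ⊕ 3 · 0≤t) ⊛ (0≤s ⊕ 2 · 0≤t)))
             (6 ·⁺ (0<x ⊛⁺ 0<t ⊛⁺ 0<t))
             (solve (P ∷ Q ∷ x ∷ D ∷ y ∷ v ∷ [])))
       , (λ (5Q≰3P : + 5 * Q ≰ + 3 * P) →
           0≤∧0<⇒+≢0 (h₁ ⊕ 4 · (ℤ.<⇒≤ (slack⁺ (ℤ.≰⇒> 5Q≰3P)) ⊛ 0≤D) ⊕ 0≤Q ⊛ ℤ.<⇒≤ 0<x) (0<t ⊛⁺ 0<x)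
             (solve (P ∷ Q ∷ x ∷ D ∷ y ∷ v ∷ [])))
       ]′ (toSum (+ 5 * Q ℤ.≤? + 3 * P))

open Certificates

module Sequence where

  open import Data.Integer using (_≤_; _<_)

  module _ {𝒜 : Set} (ψ : ℕ → 𝒜 ⊎ ℕ) where

    private
      n : ℕ → ℤ
      n = nSeq ψ

    Δ : ℕ → ℤ
    Δ i = n (suc i) - n i

    nSeq-suc≡+Δ : ∀ i → n (suc i) ≡ n i + Δ i
    nSeq-suc≡+Δ i = identity (n i) (n (suc i))
      where
      identity : ∀ a b → b ≡ a + (b - a)
      identity = solve-∀

    nth-++ˡ : ∀ (xs : List ℤ) {y j} → j ℕ.< length xs → nth ψ (xs ++ [ y ]) j ≡ nth ψ xs j
    nth-++ˡ (x ∷ xs) {j = zero}  _         = refl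
    nth-++ˡ (x ∷ xs) {j = suc j} (s≤s j<l) = nth-++ˡ xs j<l

    nth-++-length : ∀ (xs : List ℤ) {y} → nth ψ (xs ++ [ y ]) (length xs) ≡ y
    nth-++-length []       = refl
    nth-++-length (x ∷ xs) = nth-++-length xs

    length-table : ∀ k → length (table ψ k) ≡ k
    length-table zero          = refl
    length-table (suc zero)    = refl
    length-table (suc (suc k)) = begin
      length (table ψ (suc (suc k)))  ≡⟨ length-++ (table ψ (suc k)) ⟩
      length (table ψ (suc k)) ℕ.+ 1  ≡⟨ cong (ℕ._+ 1) (length-table (suc k)) ⟩
      suc k ℕ.+ 1                     ≡⟨ ℕ.+-comm (suc k) 1 ⟩
      suc (suc k)                     ∎
      where open ≡-Reasoning

    nth-table : ∀ i {j} → j ℕ.< i → nth ψ (table ψ i) j ≡ n (suc j)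
    nth-table (suc i) j<1+i with ℕ.m<1+n⇒m<n∨m≡n j<1+i
    ... | inj₂ refl = refl
    nth-table (suc (suc k)) _ | inj₁ j<1+k =
      trans (nth-++ˡ (table ψ (suc k)) (subst (_ ℕ.<_) (sym (length-table (suc k))) j<1+k))
            (nth-table (suc k) j<1+k)

    nSeq-step : ∀ {k v} → ψ (suc k) ≡ v → n (suc (suc k)) ≡ step ψ v (n (suc k)) (table ψ (suc k))
    nSeq-step {k} refl = subst (λ l → nth ψ (table ψ (suc k) ++ [ next ]) l ≡ next)
                               (length-table (suc k)) (nth-++-length (table ψ (suc k)))
      where
      next : ℤ
      next = step ψ (ψ (suc k)) (n (suc k)) (table ψ (suc k))

    nSeq-suc-inj₁ : ∀ {i a} → 1 ℕ.≤ i → ψ i ≡ inj₁ a → n (suc i) ≡ + 2 * n i + 1ℤ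
    nSeq-suc-inj₁ {suc k} _ = nSeq-step

    nSeq-suc-inj₂ : ∀ {i m} → 1 ℕ.≤ m → m ℕ.≤ i → ψ i ≡ inj₂ m → n (suc i) ≡ + 2 * n i - n m
    nSeq-suc-inj₂ {suc k} {suc m} _ m<1+k ψi≡m =
      trans (nSeq-step ψi≡m) (cong (_-_ (+ 2 * n (suc k))) (nth-table (suc k) m<1+k))

    Δ-inj₁ : ∀ {i a} → 1 ℕ.≤ i → ψ i ≡ inj₁ a → Δ i ≡ n i + 1ℤ
    Δ-inj₁ {i} 1≤i ψi≡a = trans (cong (_- n i) (nSeq-suc-inj₁ 1≤i ψi≡a)) (identity (n i))
      where
      identity : ∀ a → + 2 * a + 1ℤ - a ≡ a + 1ℤ
      identity = solve-∀

    Δ-inj₂ : ∀ {i m} → 1 ℕ.≤ m → m ℕ.≤ i → ψ i ≡ inj₂ m → Δ i ≡ n i - n m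
    Δ-inj₂ {i} {m} 1≤m m≤i ψi≡m =
      trans (cong (_- n i) (nSeq-suc-inj₂ 1≤m m≤i ψi≡m)) (identity (n i) (n m))
      where
      identity : ∀ a b → + 2 * a - b - a ≡ a - b
      identity = solve-∀

  module _ {p} {P : ℕ → Set p} (P? : Decidable P) where

    last-before : ∀ {k t} → P k → k ℕ.< t →
      ∃[ j ] (P j × j ℕ.< t × (∀ c → j ℕ.< c → c ℕ.< t → ¬ P c))
    last-before {k} {suc t} Pk (s≤s k≤t) with P? t
    ... | yes Pt = t , Pt , ℕ.n<1+n t , λ c t<c c<1+t _ → ℕ.<⇒≱ t<c (ℕ.≤-pred c<1+t)
    ... | no ¬Pt with last-before Pk (ℕ.≤∧≢⇒< k≤t λ { refl → ¬Pt Pk })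
    ...   | j , Pj , j<t , none = j , Pj , ℕ.m<n⇒m<1+n j<t , none′
      where
      none′ : ∀ c → j ℕ.< c → c ℕ.< suc t → ¬ P c
      none′ c j<c c<1+t with ℕ.m<1+n⇒m<n∨m≡n c<1+t
      ... | inj₁ c<t  = none c j<c c<t
      ... | inj₂ refl = ¬Pt

  module _ {𝒜 : Set} {ψ : ℕ → 𝒜 ⊎ ℕ} where

    private
      n : ℕ → ℤ
      n = nSeq ψ

    InT? : Decidable (InT ψ)
    InT? i = (1 ℕ.≤? i) ×-dec kind? (ψ i)
      where
      kind? : ∀ v → Dec ((∃[ a ] v ≡ inj₁ a) ⊎ (∃[ m ] (v ≡ inj₂ m × 1 ℕ.≤ m × m ℕ.≤ i ∸ 2)))
      kind? (inj₁ a) = yes (inj₁ (a , refl))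
      kind? (inj₂ m) = map′ (λ (1≤m , m≤i-2) → inj₂ (m , refl , 1≤m , m≤i-2))
                            (λ { (inj₂ (_ , refl , 1≤m , m≤i-2)) → 1≤m , m≤i-2 })
                            ((1 ℕ.≤? m) ×-dec (m ℕ.≤? i ∸ 2))

    module _ (isF : IsFunction ψ) where

      1∈T : InT ψ 1
      1∈T with isF 1 (s≤s z≤n)
      ... | inj₁ letter              = s≤s z≤n , inj₁ letter
      ... | inj₂ (_ , _ , 1≤m , m≤0) = contradiction (ℕ.≤-trans 1≤m m≤0) λ ()

      back-reference-bounds : ∀ {i m} → 1 ℕ.≤ i → ψ i ≡ inj₂ m → 1 ℕ.≤ m × m ℕ.< i
      back-reference-bounds {suc k} 1≤i ψi≡m with isF (suc k) 1≤i
      ... | inj₁ (_ , ψi≡a) = contradiction (trans (sym ψi≡m) ψi≡a) λ ()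
      ... | inj₂ (_ , ψi≡m′ , 1≤m , m≤k) with inj₂-injective (trans (sym ψi≡m) ψi≡m′)
      ...   | refl = 1≤m , s≤s m≤k

      ψ≡pred-outside-T : ∀ {i} → 2 ℕ.≤ i → ¬ InT ψ i → ψ i ≡ inj₂ (i ∸ 1)
      ψ≡pred-outside-T {i@(suc (suc k))} (s≤s (s≤s z≤n)) i∉T with isF i (s≤s z≤n)
      ... | inj₁ letter = contradiction (s≤s z≤n , inj₁ letter) i∉T
      ... | inj₂ (m , ψi≡m , 1≤m , m≤1+k) with m ℕ.≤? k
      ...   | yes m≤k = contradiction (s≤s z≤n , inj₂ (m , ψi≡m , 1≤m , m≤k)) i∉T
      ...   | no m≰k  = subst (λ m → ψ i ≡ inj₂ m) (ℕ.≤-antisym m≤1+k (ℕ.≰⇒> m≰k)) ψi≡m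

      predecessor : ∀ {t} → InT ψ t → 2 ℕ.≤ t → ∃[ t′ ] Consecutive ψ t′ t
      predecessor t∈T 2≤t with last-before InT? 1∈T 2≤t
      ... | t′ , t′∈T , t′<t , none = t′ , t′∈T , t∈T , t′<t , none

      mutual
        nSeq-<-suc : ∀ k → n (suc k) < n (suc (suc k))
        nSeq-<-suc k with isF (suc k) (s≤s z≤n)
        ... | inj₁ (_ , ψi≡a) =
          subst (n (suc k) <_) (sym (nSeq-suc-inj₁ ψ (s≤s z≤n) ψi≡a))
                (0≤i⇒i<2i+1 (nSeq-nonNeg-suc k))
        ... | inj₂ (m , ψi≡m , 1≤m , m≤k) =
          subst (n (suc k) <_) (sym (nSeq-suc-inj₂ ψ 1≤m (ℕ.m≤n⇒m≤1+n m≤k) ψi≡m))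
                (j<i⇒i<2i-j (nSeq-< k 1≤m m≤k))

        nSeq-< : ∀ k {j} → 1 ℕ.≤ j → j ℕ.≤ k → n j < n (suc k)
        nSeq-< zero    (s≤s _) ()
        nSeq-< (suc k) 1≤j j≤1+k with ℕ.m≤n⇒m<n∨m≡n j≤1+k
        ... | inj₁ (s≤s j≤k) = ℤ.<-trans (nSeq-< k 1≤j j≤k) (nSeq-<-suc k)
        ... | inj₂ refl      = nSeq-<-suc k

        nSeq-nonNeg-suc : ∀ k → 0ℤ ≤ n (suc k)
        nSeq-nonNeg-suc zero    = ℤ.≤-refl
        nSeq-nonNeg-suc (suc k) = ℤ.<⇒≤ (nSeq-< (suc k) (s≤s z≤n) (s≤s z≤n))

      -- n 0 = 0 through the default value of nth, so the next two lemmas hold from index 0.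
      nSeq-nonNeg : ∀ i → 0ℤ ≤ n i
      nSeq-nonNeg zero    = ℤ.≤-refl
      nSeq-nonNeg (suc k) = nSeq-nonNeg-suc k

      nSeq-mono-≤ : ∀ {j i} → j ℕ.≤ i → n j ≤ n i
      nSeq-mono-≤ {zero}  {i}     _         = nSeq-nonNeg i
      nSeq-mono-≤ {suc j} {suc k} (s≤s j≤k) with ℕ.m≤n⇒m<n∨m≡n j≤k
      ... | inj₁ j<k  = ℤ.<⇒≤ (nSeq-< k (s≤s z≤n) j<k)
      ... | inj₂ refl = ℤ.≤-refl

      nSeq-pos : ∀ {i} → 2 ℕ.≤ i → 0ℤ < n i
      nSeq-pos (s≤s 1≤k) = nSeq-< _ ℕ.≤-refl 1≤k

      +≤nSeq : ∀ k → + k ≤ n (suc k)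
      +≤nSeq zero    = ℤ.≤-refl
      +≤nSeq (suc k) = ℤ.i<j⇒suc[i]≤j (ℤ.≤-<-trans (+≤nSeq k) (nSeq-<-suc k))

      Δ-outside-T : ∀ {i} → 2 ℕ.≤ i → ¬ InT ψ i → Δ ψ i ≡ Δ ψ (i ∸ 1)
      Δ-outside-T 2≤i@(s≤s 1≤i-1) i∉T = Δ-inj₂ ψ 1≤i-1 (ℕ.n≤1+n _) (ψ≡pred-outside-T 2≤i i∉T)

      Δ-constant : ∀ {t′ t i} → Consecutive ψ t′ t → t′ ℕ.≤ i → i ℕ.< t → Δ ψ i ≡ Δ ψ t′
      Δ-constant C@((1≤t′ , _) , _ , _ , none) t′≤i i<t with ℕ.m≤n⇒m<n∨m≡n t′≤i
      ... | inj₂ refl = refl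
      ... | inj₁ t′<i@(s≤s t′≤i-1) =
        trans (Δ-outside-T (s≤s (ℕ.≤-trans 1≤t′ t′≤i-1)) (none _ t′<i i<t))
              (Δ-constant C t′≤i-1 (ℕ.<-trans (ℕ.n<1+n _) i<t))

      nSeq-linear : ∀ {t′ t} → Consecutive ψ t′ t → ∀ j → t′ ℕ.+ j ℕ.≤ t →
        n (t′ ℕ.+ j) ≡ n t′ + + j * Δ ψ t′
      nSeq-linear {t′} C zero _ = trans (cong n (ℕ.+-identityʳ t′)) (identity (n t′) (Δ ψ t′))
        where
        identity : ∀ a d → a ≡ a + + 0 * d
        identity = solve-∀
      nSeq-linear {t′} {t} C (suc j) t′+1+j≤t = begin
        n (t′ ℕ.+ suc j)                ≡⟨ cong n (ℕ.+-suc t′ j) ⟩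
        n (suc (t′ ℕ.+ j))              ≡⟨ nSeq-suc≡+Δ ψ (t′ ℕ.+ j) ⟩
        n (t′ ℕ.+ j) + Δ ψ (t′ ℕ.+ j)   ≡⟨ cong₂ _+_ (nSeq-linear C j (ℕ.<⇒≤ t′+j<t))
                                                     (Δ-constant C (ℕ.m≤m+n t′ j) t′+j<t) ⟩
        n t′ + + j * Δ ψ t′ + Δ ψ t′    ≡⟨ identity (n t′) (+ j) (Δ ψ t′) ⟩
        n t′ + + suc j * Δ ψ t′         ∎
        where
        open ≡-Reasoning
        t′+j<t : t′ ℕ.+ j ℕ.< t
        t′+j<t = subst (ℕ._≤ t) (ℕ.+-suc t′ j) t′+1+j≤t
        identity : ∀ a k d → a + k * d + d ≡ a + (1ℤ + k) * d
        identity = solve-∀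

      module _ (red : Reduced ψ) where

        -- If ψ(t) = m then Δ t = n (t − 1) + Δ t′ − n m for the predecessor t′ of t,
        -- and reducedness puts m below t′.
        nSeq-pred≤Δ : ∀ {t} → 2 ℕ.≤ t → InT ψ t → n (ℕ.pred t) ≤ Δ ψ t
        nSeq-pred≤Δ (s≤s 1≤s) = go (<-wellFounded _) 1≤s
          where
          open ℤ.≤-Reasoning
          go : ∀ {s} → Acc ℕ._<_ s → 1 ℕ.≤ s → InT ψ (suc s) → n s ≤ Δ ψ (suc s)
          go {s} _ _ (_ , inj₁ (_ , ψt≡a)) = begin
            n s            ≤⟨ nSeq-mono-≤ (ℕ.n≤1+n s) ⟩
            n (suc s)      ≤⟨ ℤ.i≤i+j (n (suc s)) 1ℤ ⟩
            n (suc s) + 1ℤ ≡⟨ Δ-inj₁ ψ (s≤s z≤n) ψt≡a ⟨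
            Δ ψ (suc s)    ∎
          go {s} (acc below) 1≤s t∈T@(_ , inj₂ (m , ψt≡m , 1≤m , _)) with predecessor t∈T (s≤s 1≤s)
          ... | zero , ((() , _) , _)
          ... | suc s′ , C@(t′∈T , _ , t′<t , _) with red (suc s′) (suc s) C
          ...   | _ , inj₁ (_ , ψt≡a) = contradiction (trans (sym ψt≡m) ψt≡a) λ ()
          ...   | _ , inj₂ (_ , ψt≡m′ , s≤s m≤s′) with inj₂-injective (trans (sym ψt≡m′) ψt≡m)
          ...     | refl = begin
            n s                ≤⟨ i≤i+j-k n[m]≤Δs ⟩
            n s + Δ ψ s - n m  ≡⟨ cong (_- n m) (nSeq-suc≡+Δ ψ s) ⟨
            n (suc s) - n m    ≡⟨ Δ-inj₂ ψ 1≤m (ℕ.m≤n⇒m≤1+n (ℕ.≤-trans m≤s′ (ℕ.<⇒≤ s′<s))) ψt≡m ⟨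
            Δ ψ (suc s)        ∎
            where
            s′<s : s′ ℕ.< s
            s′<s = ℕ.≤-pred t′<t
            n[m]≤Δs : n m ≤ Δ ψ s
            n[m]≤Δs = begin
              n m            ≤⟨ nSeq-mono-≤ m≤s′ ⟩
              n s′           ≤⟨ go (below s′<s) (ℕ.≤-trans 1≤m m≤s′) t′∈T ⟩
              Δ ψ (suc s′)   ≡⟨ Δ-constant C s′<s (ℕ.n<1+n s) ⟨
              Δ ψ s          ∎

open Sequence

module Tail {𝒜 : Set} {ψ : ℕ → 𝒜 ⊎ ℕ} (isF : IsFunction ψ) (red : Reduced ψ)
  {p q N : ℕ} (1≤q : 1 ℕ.≤ q) (p²<3q² : p ℕ.* p ℕ.< 3 ℕ.* (q ℕ.* q))
  (ratio : ∀ i → N ℕ.≤ i → + q * nSeq ψ (suc i) ℤ.≤ + p * nSeq ψ i) where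

  open import Data.Integer using (_≤_; _<_)

  private
    n : ℕ → ℤ
    n = nSeq ψ

    P Q : ℤ
    P = + p
    Q = + q

    0≤P : 0ℤ ≤ P
    0≤P = +≤+ z≤n

    0≤Q : 0ℤ ≤ Q
    0≤Q = +≤+ z≤n

    P²<3Q² : P * P < + 3 * (Q * Q)
    P²<3Q² = subst₂ _<_ (ℤ.pos-* p p) (trans (ℤ.pos-* 3 (q ℕ.* q)) (cong (+ 3 *_) (ℤ.pos-* q q)))
                    (+<+ p²<3q²)

    4P<7Q : + 4 * P < + 7 * Q
    4P<7Q = P²<3Q²⇒4P<7Q 0≤P 0≤Q P²<3Q²

    P<2Q : P < + 2 * Q
    P<2Q = 4P<7Q⇒P<2Q 0≤Q 4P<7Q

    c : ℕ
    c = ∣ Q * n N ∣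

    K≤⇒2+c≤ : ∀ {a} → N ℕ.+ suc (suc c) ℕ.≤ a → suc (suc c) ℕ.≤ a
    K≤⇒2+c≤ = ℕ.≤-trans (ℕ.m≤n+m _ N)

  no-letter : ∀ {i a} → N ℕ.≤ i → 1 ℕ.≤ i → ψ i ≢ inj₁ a
  no-letter {i} N≤i 1≤i ψi≡a = ℤ.<-asym P<2Q (letter⇒2Q<P (+<+ 1≤q) (nSeq-nonNeg isF i)
    (subst (λ u → Q * u ≤ P * n i) (nSeq-suc-inj₁ ψ 1≤i ψi≡a) (ratio i N≤i)))

  ratio-at-back-reference : ∀ {i m} → N ℕ.≤ i → 1 ℕ.≤ i → ψ i ≡ inj₂ m →
    Q * (+ 2 * n i - n m) ≤ P * n i
  ratio-at-back-reference {i} N≤i 1≤i ψi≡m with back-reference-bounds isF 1≤i ψi≡m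
  ... | 1≤m , m<i =
    subst (λ u → Q * u ≤ P * n i) (nSeq-suc-inj₂ ψ 1≤m (ℕ.<⇒≤ m<i) ψi≡m) (ratio i N≤i)

  -- K makes both N ≤ a and Q · n N < n a hold for a ≥ K, since n (k + 1) ≥ k.
  K : ℕ
  K = N ℕ.+ suc (suc c)

  K≤⇒N≤ : ∀ {a} → K ℕ.≤ a → N ℕ.≤ a
  K≤⇒N≤ = ℕ.≤-trans (ℕ.m≤m+n N _)

  K≤⇒2≤ : ∀ {a} → K ℕ.≤ a → 2 ℕ.≤ a
  K≤⇒2≤ K≤a = ℕ.≤-trans (s≤s (s≤s z≤n)) (K≤⇒2+c≤ K≤a)

  K≤⇒Q*n[N]<n : ∀ {a} → K ℕ.≤ a → Q * n N < n a
  K≤⇒Q*n[N]<n {a} K≤a = begin-strict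
    Q * n N          ≡⟨ ℤ.0≤i⇒+∣i∣≡i (0≤Q ⊛ nSeq-nonNeg isF N) ⟨
    + c              <⟨ +<+ (ℕ.n<1+n c) ⟩
    + suc c          ≤⟨ +≤nSeq isF (suc c) ⟩
    n (suc (suc c))  ≤⟨ nSeq-mono-≤ isF (K≤⇒2+c≤ K≤a) ⟩
    n a              ∎
    where open ℤ.≤-Reasoning

  N<back-reference : ∀ {a μ} → K ℕ.≤ a → ψ a ≡ inj₂ μ → N ℕ.< μ
  N<back-reference {a} K≤a ψa≡μ = ℕ.≰⇒> λ μ≤N →
    ℤ.<⇒≱ P<2Q (small-reference⇒2Q≤P 0≤Q (nSeq-nonNeg isF a) (K≤⇒Q*n[N]<n K≤a)
                  (nSeq-mono-≤ isF μ≤N)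
                  (ratio-at-back-reference (K≤⇒N≤ K≤a) (ℕ.<⇒≤ (K≤⇒2≤ K≤a)) ψa≡μ))

  module _ {a′ a b μ m : ℕ} (N≤a′ : N ℕ.≤ a′) (C′ : Consecutive ψ a′ a) (C : Consecutive ψ a b)
           (ψa≡μ : ψ a ≡ inj₂ μ) (μ<a′ : μ ℕ.< a′) (ψb≡m : ψ b ≡ inj₂ m) where

    private
      1≤a : 1 ℕ.≤ a
      1≤a = proj₁ (proj₁ C)

      a′<a : a′ ℕ.< a
      a′<a = proj₁ (proj₂ (proj₂ C′))

      a<b : a ℕ.< b
      a<b = proj₁ (proj₂ (proj₂ C))

      1≤μ : 1 ℕ.≤ μ
      1≤μ = proj₁ (back-reference-bounds isF 1≤a ψa≡μ)

      2≤a′ : 2 ℕ.≤ a′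
      2≤a′ = ℕ.≤-trans (s≤s 1≤μ) μ<a′

      N≤a : N ℕ.≤ a
      N≤a = ℕ.≤-trans N≤a′ (ℕ.<⇒≤ a′<a)

      x D y z : ℤ
      x = n a′
      D = Δ ψ a′
      y = n a
      z = n b

      0<x : 0ℤ < x
      0<x = nSeq-pos isF 2≤a′

      before-a′⇒≤D : ∀ {j} → j ℕ.< a′ → n j ≤ D
      before-a′⇒≤D j<a′ =
        ℤ.≤-trans (nSeq-mono-≤ isF (ℕ.<⇒≤pred j<a′)) (nSeq-pred≤Δ isF red 2≤a′ (proj₁ C′))

      0≤D : 0ℤ ≤ D
      0≤D = ℤ.≤-trans (nSeq-nonNeg isF 0) (before-a′⇒≤D (ℕ.<-trans (s≤s z≤n) 2≤a′))

      step-x : Q * (x + D) ≤ P * x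
      step-x = subst (λ u → Q * u ≤ P * x) (nSeq-suc≡+Δ ψ a′) (ratio a′ N≤a′)

      step-y : Q * (+ 2 * y - n μ) ≤ P * y
      step-y = ratio-at-back-reference N≤a 1≤a ψa≡μ

      step-z : Q * (+ 2 * z - n m) ≤ P * z
      step-z = ratio-at-back-reference (ℕ.≤-trans N≤a (ℕ.<⇒≤ a<b)) (proj₁ (proj₁ (proj₂ C))) ψb≡m

      2y-v≤z : + 2 * y - n μ ≤ z
      2y-v≤z = subst (_≤ z) (nSeq-suc-inj₂ ψ 1≤μ (ℕ.<⇒≤ (ℕ.<-trans μ<a′ a′<a)) ψa≡μ)
                     (nSeq-mono-≤ isF a<b)

      x+kD≤y : ∀ k → a′ ℕ.+ k ℕ.≤ a → x + + k * D ≤ y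
      x+kD≤y k a′+k≤a = subst (_≤ y) (nSeq-linear isF C′ k a′+k≤a) (nSeq-mono-≤ isF a′+k≤a)

    ¬back-reference-before-pred : ¬ (suc m ℕ.< a)
    ¬back-reference-before-pred m+1<a with m ℕ.<? a′
    ... | yes m<a′ = ℤ.<⇒≱ P²<3Q² (reference-below-D⇒3Q²≤P² {P} {Q} 0≤Q (ℤ.<⇒≤ P<2Q) 0≤D 0<x
        step-x x+D≤y (before-a′⇒≤D μ<a′) 2y-v≤z (before-a′⇒≤D m<a′) step-z)
      where
      x+D≤y : x + D ≤ y
      x+D≤y = subst (λ d → x + d ≤ y) (ℤ.*-identityˡ D)
                    (x+kD≤y 1 (subst (ℕ._≤ a) (ℕ.+-comm 1 a′) a′<a))
    ... | no m≮a′ with a′ ℕ.+ 3 ℕ.≤? a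
    ...   | yes a′+3≤a = ℤ.<⇒≱ 4P<7Q (three-steps⇒7Q≤4P {P} {Q} 0≤Q 0≤D 0<x step-x
        (x+kD≤y 3 a′+3≤a) (before-a′⇒≤D μ<a′) step-y)
    ...   | no a′+3≰a = ℤ.<⇒≱ P²<3Q² (reference-to-x⇒3Q²≤P² {P} {Q} 0≤Q (ℤ.<⇒≤ P<2Q) 0≤D 0<x
        (x+kD≤y 2 a′+2≤a) (before-a′⇒≤D μ<a′) step-y 2y-v≤z step-z′)
      where
      a′≤m : a′ ℕ.≤ m
      a′≤m = ℕ.≮⇒≥ m≮a′
      a≤2+a′ : a ℕ.≤ 2 ℕ.+ a′
      a≤2+a′ = ℕ.≤-pred (subst (a ℕ.<_) (ℕ.+-comm a′ 3) (ℕ.≰⇒> a′+3≰a))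
      a′+2≤a : a′ ℕ.+ 2 ℕ.≤ a
      a′+2≤a = subst (ℕ._≤ a) (ℕ.+-comm 2 a′) (ℕ.≤-trans (s≤s (s≤s a′≤m)) m+1<a)
      m≡a′ : m ≡ a′
      m≡a′ = ℕ.≤-antisym (ℕ.≤-pred (ℕ.≤-pred (ℕ.≤-trans m+1<a a≤2+a′))) a′≤m
      step-z′ : Q * (+ 2 * z - x) ≤ P * z
      step-z′ = subst (λ j → Q * (+ 2 * z - n j) ≤ P * z) m≡a′ step-z

  ψ≡pred-beyond-K : ∀ a b → K ℕ.≤ a → Consecutive ψ a b → ψ b ≡ inj₂ (a ∸ 1)
  ψ≡pred-beyond-K a b K≤a C@(a∈T , (1≤b , _) , a<b , _) with red a b C
  ... | _ , inj₁ (_ , ψb≡letter) =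
    ⊥-elim (no-letter (ℕ.≤-trans (K≤⇒N≤ K≤a) (ℕ.<⇒≤ a<b)) 1≤b ψb≡letter)
  ... | _ , inj₂ (m , ψb≡m , m<a) with m ℕ.≟ a ∸ 1
  ...   | yes refl = ψb≡m
  ...   | no m≢a-1 with predecessor isF a∈T (K≤⇒2≤ K≤a)
  ...     | a′ , C′ with red a′ a C′
  ...       | _ , inj₁ (_ , ψa≡letter) = ⊥-elim (no-letter (K≤⇒N≤ K≤a) (proj₁ a∈T) ψa≡letter)
  ...       | _ , inj₂ (μ , ψa≡μ , μ<a′) =
    ⊥-elim (¬back-reference-before-pred N≤a′ C′ C ψa≡μ μ<a′ ψb≡m m+1<a)
    where
    N≤a′ : N ℕ.≤ a′
    N≤a′ = ℕ.<⇒≤ (ℕ.<-trans (N<back-reference K≤a ψa≡μ) μ<a′)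
    m+1<a : suc m ℕ.< a
    m+1<a = ℕ.≤∧≢⇒< m<a (λ m+1≡a → m≢a-1 (cong (_∸ 1) m+1≡a))

open import Data.Nat using (_≤_)

-- The second alternative is proved outright; for finite (t_k) it holds vacuously.
lemma7p1 : {𝒜 : Set} (ψ : ℕ → 𝒜 ⊎ ℕ) → IsFunction ψ → Reduced ψ → DeltaLtSqrt3 ψ →
    TFinite ψ ⊎ (∃[ K ] (∀ a b → K ≤ a → Consecutive ψ a b → ψ b ≡ inj₂ (a ∸ 1)))
lemma7p1 ψ isF red (p , q , 1≤q , p²<3q² , N , ratio) = inj₂ (K , ψ≡pred-beyond-K)
  where open Tail isF red {p} {q} {N} 1≤q p²<3q² ratio
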